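{- Let $\vec G$ be any feasible PV graph whose sites have distinct identifiers, and suppose the agent is given the number $n$ of sites (but no bound on the system period and no knowledge of $k$). Then Algorithm Hitch-a-guessing-ride, executed from any starting site, visits every site of $\vec G$ and halts after finitely many moves.
   Context: A PV system consists of a finite set $S$ of $n$ sites, here with distinct identifiers, and a set $C$ of $k$ carriers; each carrier $c$ has a unique identifier and a route $\pi(c)=\langle x_0,\dots,x_{p(c)-1}\rangle$ of sites, with period $p(c)$ and $\pi(c)[j]=x_{j\bmod p(c)}$; at each time $t=0,1,\dots$ carrier $c$ moves from $\pi(c)[t]$ to $\pi(c)[t+1]$. The system period is $p=\max_c p(c)$. Carriers $a,b$ meet at time $t$ if $\pi(a)[t]=\pi(b)[t]$. An exploring agent is placed at time $0$ at a starting site $x\in\{\pi(c)[0]\}$; at each time $t$, at site $y$, it observes the id of $y$ and the identifiers of carriers $c$ with $\pi(c)[t]=y$, and either halts or moves with one such carrier to $\pi(c)[t+1]$ (one move); "riding with $c$" means repeatedly choosing $c$, and the agent may switch to a carrier it meets. The PV graph is feasible if from every starting site some finite sequence of moves visits all sites. Algorithm Hitch-a-guessing-ride: the agent keeps a set Visited of sites it has been at (never reset), a current guess $g$ (initially a fixed positive constant $g_0$), a Home carrier (initially a carrier present at the start site), parent pointers (Home has none) and a set Encountered of carriers (initially $\{\text{Home}\}$). Procedure on carrier $c$: if $|\text{Visited}|=n$, halt. Otherwise ride with $c$ for up to $g$ time units, adding each site reached to Visited; if during this ride it meets a carrier $c'\notin$ Encountered, it adds $c'$ to Encountered, sets $\mathrm{parent}(c')=c$,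 switches to $c'$ and runs the procedure on $c'$. If the $g$ time units elapse without this happening: if $c$ is the Home, it halts when $|\text{Visited}|=n$ and otherwise restarts; if $c$ is not the Home, it backtracks, riding with $c$ (adding sites to Visited) until it meets $\mathrm{parent}(c)$, but if during this ride it meets a carrier not in Encountered or $g$ time units elapse, it restarts; otherwise it switches to $\mathrm{parent}(c)$ and runs the procedure on it. Restart (on the current carrier $c$): set $g:=2g$, Home $:=c$ with no parent, Encountered $:=\{c\}$ (Visited is kept), and run the procedure on $c$. -}

module Defs where

open import Data.Nat using (ℕ; zero; suc; _+_; _*_; _≤_; NonZero; _≡ᵇ_)
open import Data.Nat.DivMod using (_mod_)
open import Data.Fin using (Fin; _≟_)
open import Data.Fin.Subset using (Subset; ⁅_⁆; _∪_; ∣_∣; inside)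
open import Data.Vec using (lookup; _[_]≔_)
open import Data.Bool using (Bool; true; false; if_then_else_; not; _∧_)
open import Data.List using (List; []; _∷_)
open import Data.List.Membership.Propositional using (_∈_)
open import Data.Maybe using (Maybe; just; nothing)
open import Data.Product using (Σ; ∃; _×_; _,_)
open import Data.Unit using (⊤)
open import Data.Fin.Base using (toℕ)
open import Relation.Nullary.Decidable using (⌊_⌋)
open import Relation.Binary.PropositionalEquality using (_≡_)

-- Sites are Fin n (identifiers = the sites themselves, hence
-- distinct); carriers are Fin k.

record PV (n k : ℕ) : Set where
  field
    period     : Fin k → ℕ
    period≢0   : (c : Fin k) → NonZero (period c)
    route      : (c : Fin k) → Fin (period c) → Fin n

  pos : Fin k → ℕ → Fin n
  pos c t = route c (_mod_ t (period c) {{period≢0 c}})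

open PV public

ValidMoves : ∀ {n k} → PV n k → ℕ → Fin n → List (Fin k) → Set
ValidMoves G t y []       = ⊤
ValidMoves G t y (c ∷ cs) = pos G c t ≡ y × ValidMoves G (suc t) (pos G c (suc t)) cs

sitesOf : ∀ {n k} → PV n k → ℕ → Fin n → List (Fin k) → List (Fin n)
sitesOf G t y []       = y ∷ []
sitesOf G t y (c ∷ cs) = y ∷ sitesOf G (suc t) (pos G c (suc t)) cs

-- starting sites are the sites π(c)[0]; from each of them some finite
-- sequence of moves (starting at time 0) visits all sites.
Feasible : ∀ {n k} → PV n k → Set
Feasible {n} {k} G =
  (x : Fin n) → (∃ λ (c : Fin k) → pos G c 0 ≡ x) →
  ∃ λ (cs : List (Fin k)) → ValidMoves G 0 x cs × ((z : Fin n) → z ∈ sitesOf G 0 x cs)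

-- Algorithm Hitch-a-guessing-ride as a (deterministic) state machine.
-- Each step of the machine is one elementary action; moves are the steps
-- that increase the time.

data Mode : Set where
  proc   : Mode        -- start of "procedure on cur"
  ride   : ℕ → Mode    -- riding with cur, argument = time units elapsed
  back   : ℕ → Mode    -- backtracking with cur, argument = time units elapsed
  halted : Mode

record State (n k : ℕ) : Set where
  constructor st
  field
    time        : ℕ
    cur         : Fin k
    guess       : ℕ
    home        : Fin k
    parent      : Fin k → Fin k  -- only meaningful for encountered non-Home carriers
    encountered : Subset k
    visited     : Subset n
    mode        : Mode

open State public

findFirst : ∀ {A : Set} → (A → Bool) → List A → Maybe A
findFirst p []       = nothing
findFirst p (a ∷ as) = if p a then just a else findFirst p as

allCarriers : (k : ℕ) → List (Fin k)
allCarriers k = Data.List.allFin k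
  where import Data.List

module Algo {n k : ℕ} (G : PV n k) where

  site : State n k → Fin n
  site s = pos G (cur s) (time s)

  full : State n k → Bool
  full s = ∣ visited s ∣ ≡ᵇ n

  newCarrier : State n k → Maybe (Fin k)
  newCarrier s = findFirst
    (λ c → ⌊ pos G c (time s) ≟ site s ⌋ ∧ not (lookup (encountered s) c))
    (allCarriers k)

  restart : State n k → State n k
  restart s = record s { guess = 2 * guess s ; home = cur s
                       ; encountered = ⁅ cur s ⁆ ; mode = proc }

  move : State n k → Mode → State n k
  move s m = record s { time = suc (time s)
                      ; visited = visited s ∪ ⁅ pos G (cur s) (suc (time s)) ⁆
                      ; mode = m }

  switchNew : State n k → Fin k → State n k
  switchNew s c' = record s { encountered = encountered s ∪ ⁅ c' ⁆
                            ; parent = λ c → if ⌊ c ≟ c' ⌋ then cur s else parent s c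
                            ; cur = c' ; mode = proc }

  step : State n k → State n k
  step s with mode s
  ... | halted = s
  ... | proc   = if full s then record s { mode = halted } else record s { mode = ride 0 }
  ... | ride e with newCarrier s
  ...   | just c' = switchNew s c'
  ...   | nothing =
          if e ≡ᵇ guess s
          then (if ⌊ cur s ≟ home s ⌋
                then (if full s then record s { mode = halted } else restart s)
                else record s { mode = back 0 })
          else move s (ride (suc e))
  step s | back e with newCarrier s
  ...   | just _  = restart s
  ...   | nothing =
          if ⌊ pos G (parent s (cur s)) (time s) ≟ site s ⌋
          then record s { cur = parent s (cur s) ; mode = proc }
          else (if e ≡ᵇ guess s then restart s else move s (back (suc e)))

  -- initial state: Home = c0 (a carrier present at the start site
  -- π(c0)[0] at time 0), guess g0, Encountered = {Home}, Visited = {start}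
  initial : ℕ → Fin k → State n k
  initial g0 c0 = st 0 c0 g0 c0 (λ c → c) ⁅ c0 ⁆ ⁅ pos G c0 0 ⁆ proc

  run : State n k → ℕ → State n k
  run s zero    = s
  run s (suc i) = run (step s) i

  isHalted : State n k → Set
  isHalted s = mode s ≡ halted

open Algo public

module Submission where

-- Let L be the product of all carrier periods: every route is L-periodic, so
-- any L consecutive time units reproduce every configuration of the system
-- ('window').  Call a carrier linked to c0 when it is connected to c0 in the
-- meeting graph; feasibility forces every site onto the route of a linked
-- carrier ('feasible⇒covered').  The run of the algorithm is then followed by
-- three nested inductions: a ride or a backtrack lasts at most g time units
-- ('rideFor', 'backtrackFor'); one call of the procedure on a carrier halts
-- with every site visited, restarts while g < L, or returns to the parent
-- ('explore', by induction on the number of unencountered carriers); and one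
-- phase with guess g halts or restarts with guess 2g ('phase', by induction
-- on L ∸ g).  The invariant carried throughout ('Invariant') says that once
-- g ≥ L every encountered carrier off the depth-first stack is 'Finished':
-- all carriers it meets are encountered and all its sites are visited.  With
-- g ≥ L the algorithm therefore can neither restart nor stop early, so it
-- halts with all sites visited; finally every visited site is the agent's
-- site at some step ('visited⇒seen').

open import Defs
open import Data.Nat using (ℕ; zero; suc; _+_; _*_; _∸_; _≤_; _<_; z≤n; z<s; _≡ᵇ_; NonZero; _≤?_)
open import Data.Nat.Base using (>-nonZero; >-nonZero⁻¹)
open import Data.Nat.Properties
  using (≤-refl; ≤-trans; ≤-antisym; ≤-pred; <-≤-trans; <⇒≤; <⇒≢; <⇒≱; ≰⇒>
        ; m≤m+n; m<m+n; m≤n⇒m≤1+n; m≤n⇒m<n∨m≡n; *-mono-≤; *-suc; +-assoc; +-comm; +-suc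
        ; +-identityʳ; ≡ᵇ⇒≡; ≡⇒≡ᵇ; m∸n≤m; ∸-monoʳ-<; ∸-monoʳ-≤; m<n⇒0<n∸m; m≤n⇒m∸n≡0; m+[n∸m]≡n)
  renaming (_≟_ to _≟ℕ_)
open import Data.Nat.DivMod using (_%_; _/_; [m+kn]%n≡m%n; m%n<n; m≡m%n+[m/n]*n)
open import Data.Nat.Divisibility using (_∣_; divides; m∣m*n; ∣n⇒∣m*n)
open import Data.Fin using (Fin; _≟_)
open import Data.Fin.Properties using (fromℕ<-cong)
open import Data.Fin.Subset using (Subset; ⁅_⁆; _∪_; ∣_∣; _⊆_; ⊤) renaming (_∈_ to _∈ₛ_; _∉_ to _∉ₛ_)
open import Data.Fin.Subset.Properties
  using (x∈⁅x⁆; x∈⁅y⁆⇒x≡y; x∈p∪q⁻; p⊆q⇒∣p∣≤∣q∣; p⊂q⇒∣p∣<∣q∣; ∣p∣≤n; ∣⊤∣≡n; ∣p∣≡n⇒p≡⊤; ∈⊤; p⊆p∪q; q⊆p∪q)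
open import Data.Vec.Properties using ([]=⇒lookup; lookup⇒[]=)
open import Data.Bool using (Bool; true; false; if_then_else_; not)
open import Data.Bool.Properties using (T-≡; not-injective)
open import Data.List using (List; []; _∷_; allFin)
open import Data.List.Membership.Propositional using (_∈_; _∉_)
open import Data.List.Membership.Propositional.Properties using (∈-allFin)
open import Data.List.Relation.Unary.Any using (here; there)
open import Data.Maybe using (just; nothing)
open import Data.Maybe.Properties using (just-injective)
open import Data.Product using (∃; _×_; _,_; proj₁; proj₂)
open import Data.Sum using (_⊎_; inj₁; inj₂; [_,_]′)
open import Data.Empty using (⊥-elim)
open import Function.Bundles using (Equivalence)
open import Relation.Nullary using (yes; no)
open import Relation.Nullary.Decidable using (⌊_⌋; dec-true; dec-false; isYes≗does)
open import Relation.Binary.PropositionalEquality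

findFirst-just : ∀ {A : Set} (p : A → Bool) xs {a} → findFirst p xs ≡ just a → p a ≡ true
findFirst-just p (x ∷ xs) eq with p x in px
... | true  = subst (λ y → p y ≡ true) (just-injective eq) px
... | false = findFirst-just p xs eq

findFirst-nothing : ∀ {A : Set} (p : A → Bool) xs → findFirst p xs ≡ nothing →
  ∀ {a} → a ∈ xs → p a ≡ false
findFirst-nothing p (x ∷ xs) eq m with p x in px
findFirst-nothing p (x ∷ xs) eq (here refl) | false = px
findFirst-nothing p (x ∷ xs) eq (there m)   | false = findFirst-nothing p xs eq m

true≢false : true ≢ false
true≢false ()

≡ᵇ-refl : ∀ m → (m ≡ᵇ m) ≡ true
≡ᵇ-refl m = dec-true (m ≟ℕ m) refl

≡ᵇ-false : ∀ {m n} → m ≢ n → (m ≡ᵇ n) ≡ false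
≡ᵇ-false {m} {n} = dec-false (m ≟ℕ n)

≟-true : ∀ {k} {c d : Fin k} → c ≡ d → ⌊ c ≟ d ⌋ ≡ true
≟-true {c = c} {d} c≡d = trans (isYes≗does (c ≟ d)) (dec-true (c ≟ d) c≡d)

≟-false : ∀ {k} {c d : Fin k} → c ≢ d → ⌊ c ≟ d ⌋ ≡ false
≟-false {c = c} {d} c≢d = trans (isYes≗does (c ≟ d)) (dec-false (c ≟ d) c≢d)

all⇒full : ∀ {n} (V : Subset n) → (∀ z → z ∈ₛ V) → (∣ V ∣ ≡ᵇ n) ≡ true
all⇒full {n} V all = Equivalence.to T-≡ (≡⇒≡ᵇ _ _ (≤-antisym (∣p∣≤n V)
  (subst (_≤ ∣ V ∣) (∣⊤∣≡n n) (p⊆q⇒∣p∣≤∣q∣ {p = ⊤} (λ {x} _ → all x)))))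

full⇒all : ∀ {n} (V : Subset n) → (∣ V ∣ ≡ᵇ n) ≡ true → ∀ z → z ∈ₛ V
full⇒all {n} V full z = subst (z ∈ₛ_) (sym (∣p∣≡n⇒p≡⊤ (≡ᵇ⇒≡ _ _ (Equivalence.from T-≡ full)))) ∈⊤

module Correctness {n k : ℕ} (G : PV n k) where

  -- Periodicity.

  pos-shift : ∀ c t {M} → period G c ∣ M → pos G c (t + M) ≡ pos G c t
  pos-shift c t (divides q refl) =
    cong (route G c) (fromℕ<-cong _ _ ([m+kn]%n≡m%n t q (period G c) {{period≢0 G c}}) _ _)

  periodProduct : List (Fin k) → ℕ
  periodProduct []       = 1
  periodProduct (c ∷ cs) = period G c * periodProduct cs

  period∣product : ∀ {c} cs → c ∈ cs → period G c ∣ periodProduct cs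
  period∣product (d ∷ cs) (here refl) = m∣m*n (periodProduct cs)
  period∣product (d ∷ cs) (there c∈) = ∣n⇒∣m*n (period G d) (period∣product cs c∈)

  periodProduct≥1 : ∀ cs → 1 ≤ periodProduct cs
  periodProduct≥1 []       = ≤-refl
  periodProduct≥1 (c ∷ cs) = *-mono-≤ (>-nonZero⁻¹ (period G c) {{period≢0 G c}}) (periodProduct≥1 cs)

  L : ℕ
  L = periodProduct (allFin k)

  L≥1 : 1 ≤ L
  L≥1 = periodProduct≥1 (allFin k)

  instance
    L-nonZero : NonZero L
    L-nonZero = >-nonZero L≥1

  pos-shiftL : ∀ c t m → pos G c (t + m * L) ≡ pos G c t
  pos-shiftL c t m = pos-shift c t (∣n⇒∣m*n m (period∣product (allFin k) (∈-allFin c)))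

  window : ∀ T τ → ∃ λ j → j < L × (∀ c → pos G c (T + j) ≡ pos G c τ)
  window T τ = x % L , m%n<n x L , λ c → begin
      pos G c (T + x % L)             ≡⟨ sym (pos-shiftL c (T + x % L) (x / L)) ⟩
      pos G c (T + x % L + x / L * L) ≡⟨ cong (pos G c) (trans (+-assoc T _ _) (cong (T +_) (sym (m≡m%n+[m/n]*n x L)))) ⟩
      pos G c (T + x)                 ≡⟨ cong (pos G c) T+x≡τ+TL ⟩
      pos G c (τ + T * L)             ≡⟨ pos-shiftL c τ T ⟩
      pos G c τ                       ∎
    where
      open ≡-Reasoning
      x : ℕ
      x = τ + T * (L ∸ 1)
      T+x≡τ+TL : T + x ≡ τ + T * L
      T+x≡τ+TL = begin
        T + (τ + T * (L ∸ 1)) ≡⟨ sym (+-assoc T τ _) ⟩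
        T + τ + T * (L ∸ 1)   ≡⟨ cong (_+ T * (L ∸ 1)) (+-comm T τ) ⟩
        τ + T + T * (L ∸ 1)   ≡⟨ +-assoc τ T _ ⟩
        τ + (T + T * (L ∸ 1)) ≡⟨ cong (τ +_) (sym (*-suc T (L ∸ 1))) ⟩
        τ + T * suc (L ∸ 1)   ≡⟨ cong (λ m → τ + T * m) (m+[n∸m]≡n L≥1) ⟩
        τ + T * L             ∎

  -- The meeting graph.

  data Linked (a : Fin k) : Fin k → Set where
    start : Linked a a
    meet  : ∀ {b c} τ → Linked a b → pos G b τ ≡ pos G c τ → Linked a c

  linked-trans : ∀ {a b c} → Linked a b → Linked b c → Linked a c
  linked-trans ab start          = ab
  linked-trans ab (meet τ bc eq) = meet τ (linked-trans ab bc) eq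

  linked-sym : ∀ {a b} → Linked a b → Linked b a
  linked-sym start          = start
  linked-sym (meet τ ab eq) = linked-trans (meet τ start (sym eq)) (linked-sym ab)

  OnLinkedRoute : Fin k → Fin n → Set
  OnLinkedRoute a z = ∃ λ d → Linked a d × ∃ λ τ → pos G d τ ≡ z

  moves-onLinkedRoute : ∀ {a} t y cs d → Linked a d → pos G d t ≡ y → ValidMoves G t y cs →
    ∀ {z} → z ∈ sitesOf G t y cs → OnLinkedRoute a z
  moves-onLinkedRoute t y []       d ad dy valid (here refl) = d , ad , t , dy
  moves-onLinkedRoute t y (c ∷ cs) d ad dy valid (here refl) = d , ad , t , dy
  moves-onLinkedRoute t y (c ∷ cs) d ad dy (cy , valid) (there z∈) =
    moves-onLinkedRoute (suc t) _ cs c (meet t ad (trans dy (sym cy))) refl valid z∈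

  feasible⇒covered : Feasible G → ∀ a z → OnLinkedRoute a z
  feasible⇒covered feasible a z with feasible (pos G a 0) (a , refl)
  ... | cs , valid , visitsAll = moves-onLinkedRoute 0 _ cs a start refl valid (visitsAll z)

  newCarrier-just : ∀ s {c'} → newCarrier G s ≡ just c' →
    pos G c' (time s) ≡ site G s × c' ∉ₛ encountered s
  newCarrier-just s {c'} eq with pos G c' (time s) ≟ site G s | findFirst-just _ (allCarriers k) eq
  ... | yes present | unencountered =
    present , λ c'∈ → true≢false (trans (sym unencountered) (cong not ([]=⇒lookup c'∈)))

  newCarrier-nothing : ∀ s → newCarrier G s ≡ nothing →
    ∀ c' → pos G c' (time s) ≡ site G s → c' ∈ₛ encountered s
  newCarrier-nothing s eq c' present
    with pos G c' (time s) ≟ site G s | findFirst-nothing _ (allCarriers k) eq (∈-allFin c')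
  ... | yes _     | encountered = lookup⇒[]= c' _ (not-injective encountered)
  ... | no absent | _           = ⊥-elim (absent present)

  step-proc-full : ∀ t c g h par E V → full G (st t c g h par E V proc) ≡ true →
    step G (st t c g h par E V proc) ≡ st t c g h par E V halted
  step-proc-full t c g h par E V eq rewrite eq = refl

  step-proc-ride : ∀ t c g h par E V → full G (st t c g h par E V proc) ≡ false →
    step G (st t c g h par E V proc) ≡ st t c g h par E V (ride 0)
  step-proc-ride t c g h par E V eq rewrite eq = refl

  step-ride-new : ∀ t c g h par E V e c' → newCarrier G (st t c g h par E V (ride e)) ≡ just c' →
    step G (st t c g h par E V (ride e)) ≡ switchNew G (st t c g h par E V (ride e)) c'
  step-ride-new t c g h par E V e c' eq rewrite eq = refl

  step-ride-on : ∀ t c g h par E V e → newCarrier G (st t c g h par E V (ride e)) ≡ nothing → e ≢ g →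
    step G (st t c g h par E V (ride e)) ≡ move G (st t c g h par E V (ride e)) (ride (suc e))
  step-ride-on t c g h par E V e eq e≢g rewrite eq | ≡ᵇ-false e≢g = refl

  step-ride-halt : ∀ t c g par E V → newCarrier G (st t c g c par E V (ride g)) ≡ nothing →
    full G (st t c g c par E V (ride g)) ≡ true →
    step G (st t c g c par E V (ride g)) ≡ st t c g c par E V halted
  step-ride-halt t c g par E V eq fq rewrite eq | ≡ᵇ-refl g | ≟-true {c = c} refl | fq = refl

  step-ride-restart : ∀ t c g par E V → newCarrier G (st t c g c par E V (ride g)) ≡ nothing →
    full G (st t c g c par E V (ride g)) ≡ false →
    step G (st t c g c par E V (ride g)) ≡ st t c (2 * g) c par ⁅ c ⁆ V proc
  step-ride-restart t c g par E V eq fq rewrite eq | ≡ᵇ-refl g | ≟-true {c = c} refl | fq = refl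

  step-ride-backtrack : ∀ t c g h par E V → newCarrier G (st t c g h par E V (ride g)) ≡ nothing → c ≢ h →
    step G (st t c g h par E V (ride g)) ≡ st t c g h par E V (back 0)
  step-ride-backtrack t c g h par E V eq c≢h rewrite eq | ≡ᵇ-refl g | ≟-false c≢h = refl

  step-back-new : ∀ t c g h par E V e c' → newCarrier G (st t c g h par E V (back e)) ≡ just c' →
    step G (st t c g h par E V (back e)) ≡ st t c (2 * g) c par ⁅ c ⁆ V proc
  step-back-new t c g h par E V e c' eq rewrite eq = refl

  step-back-parent : ∀ t c g h par E V e → newCarrier G (st t c g h par E V (back e)) ≡ nothing →
    pos G (par c) t ≡ pos G c t →
    step G (st t c g h par E V (back e)) ≡ st t (par c) g h par E V proc
  step-back-parent t c g h par E V e eq meets rewrite eq | ≟-true meets = refl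

  step-back-restart : ∀ t c g h par E V → newCarrier G (st t c g h par E V (back g)) ≡ nothing →
    pos G (par c) t ≢ pos G c t →
    step G (st t c g h par E V (back g)) ≡ st t c (2 * g) c par ⁅ c ⁆ V proc
  step-back-restart t c g h par E V eq apart rewrite eq | ≟-false apart | ≡ᵇ-refl g = refl

  step-back-on : ∀ t c g h par E V e → newCarrier G (st t c g h par E V (back e)) ≡ nothing →
    pos G (par c) t ≢ pos G c t → e ≢ g →
    step G (st t c g h par E V (back e)) ≡ move G (st t c g h par E V (back e)) (back (suc e))
  step-back-on t c g h par E V e eq apart e≢g rewrite eq | ≟-false apart | ≡ᵇ-false e≢g = refl

  record Eventually (Q : State n k → Set) (s : State n k) : Set where
    constructor after
    field
      steps : ℕ
      holds : Q (run G s steps)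

  run-+ : ∀ s i j → run G s (i + j) ≡ run G (run G s i) j
  run-+ s zero    j = refl
  run-+ s (suc i) j = run-+ (step G s) i j

  now : ∀ {Q s} → Q s → Eventually Q s
  now q = after 0 q

  later : ∀ {Q s} → Eventually Q (step G s) → Eventually Q s
  later (after i q) = after (suc i) q

  later≡ : ∀ {Q s s'} → step G s ≡ s' → Eventually Q s' → Eventually Q s
  later≡ {Q} eq ev = later (subst (Eventually Q) (sym eq) ev)

  _then_ : ∀ {Q R s} → Eventually Q s → (∀ s' → Q s' → Eventually R s') → Eventually R s
  _then_ {R = R} {s} (after i q) continue with continue _ q
  ... | after j r = after (i + j) (subst R (sym (run-+ s i j)) r)

  -- Finished carriers and ride logs.

  Finished : Subset k → Subset n → Fin k → Set
  Finished E V d = (∀ c' τ → pos G d τ ≡ pos G c' τ → c' ∈ₛ E) × (∀ τ → pos G d τ ∈ₛ V)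

  finished-mono : ∀ {E E' V V' d} → E ⊆ E' → V ⊆ V' → Finished E V d → Finished E' V' d
  finished-mono E⊆E' V⊆V' (partners , sites) =
    (λ c' τ eq → E⊆E' (partners c' τ eq)) , (λ τ → V⊆V' (sites τ))

  -- A set of finished carriers is closed under meetings, so it contains every
  -- carrier linked to one of its members.
  finished⇒linked∈ : ∀ {E V a d} → (∀ d → d ∈ₛ E → Finished E V d) → a ∈ₛ E → Linked a d → d ∈ₛ E
  finished⇒linked∈ allFinished a∈E start            = a∈E
  finished⇒linked∈ allFinished a∈E (meet {b} τ ab eq) =
    proj₁ (allFinished b (finished⇒linked∈ allFinished a∈E ab)) _ τ eq

  record RideLog (t0 : ℕ) (c : Fin k) (e : ℕ) (E : Subset k) (V : Subset n) : Set where
    field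
      reached : ∀ j → j < e → pos G c (t0 + suc j) ∈ₛ V
      metKnown : ∀ j → j < e → ∀ c' → pos G c' (t0 + j) ≡ pos G c (t0 + j) → c' ∈ₛ E
  open RideLog

  rideLog-empty : ∀ {t0 c E V} → RideLog t0 c 0 E V
  rideLog-empty = record { reached = λ _ () ; metKnown = λ _ () }

  rideLog-extend : ∀ {t0 c e E V} → RideLog t0 c e E V →
    (∀ c' → pos G c' (t0 + e) ≡ pos G c (t0 + e) → c' ∈ₛ E) →
    RideLog t0 c (suc e) E (V ∪ ⁅ pos G c (t0 + suc e) ⁆)
  rideLog-extend {V = V} log known = record
    { reached  = λ j j≤e → [ (λ j<e → p⊆p∪q _ (reached log j j<e))
                           , (λ { refl → q⊆p∪q V _ (x∈⁅x⁆ _) }) ]′ (m≤n⇒m<n∨m≡n (≤-pred j≤e))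
    ; metKnown = λ j j≤e → [ metKnown log j , (λ { refl → known }) ]′ (m≤n⇒m<n∨m≡n (≤-pred j≤e)) }

  rideLog-finished : ∀ {t0 c g E V} → RideLog t0 c g E V → L ≤ g → Finished E V c
  rideLog-finished {t0} {c} {g} {E} {V} log long = partners , sites
    where
      partners : ∀ c' τ → pos G c τ ≡ pos G c' τ → c' ∈ₛ E
      partners c' τ eq with window t0 τ
      ... | j , j<L , same =
        metKnown log j (<-≤-trans j<L long) c' (trans (same c') (trans (sym eq) (sym (same c))))
      sites : ∀ τ → pos G c τ ∈ₛ V
      sites τ with window (suc t0) τ
      ... | j , j<L , same =
        subst (_∈ₛ V) (trans (cong (pos G c) (+-suc t0 j)) (same c)) (reached log j (<-≤-trans j<L long))

  after-move : ∀ {Q} t0 e c g h par E V m m' →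
    Eventually Q (st (t0 + suc e) c g h par E (V ∪ ⁅ pos G c (t0 + suc e) ⁆) m') →
    Eventually Q (move G (st (t0 + e) c g h par E V m) m')
  after-move {Q} t0 e c g h par E V m m' =
    subst (λ T → Eventually Q (st T c g h par E (V ∪ ⁅ pos G c T ⁆) m')) (+-suc t0 e)

  adopt : (Fin k → Fin k) → Fin k → Fin k → Fin k → Fin k
  adopt par c c' d = if ⌊ d ≟ c' ⌋ then c else par d

  data RideEnd (t0 : ℕ) (c : Fin k) (g : ℕ) (h : Fin k) (par : Fin k → Fin k) (E : Subset k) (V : Subset n)
               (s : State n k) : Set where
    metNew  : ∀ {t c' V'} → s ≡ st t c' g h (adopt par c c') (E ∪ ⁅ c' ⁆) V' proc →
              c' ∉ₛ E → pos G c' t ≡ pos G c t → V ⊆ V' → RideEnd t0 c g h par E V s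
    expired : ∀ {V'} → s ≡ st (t0 + g) c g h par E V' (ride g) →
              newCarrier G (st (t0 + g) c g h par E V' (ride g)) ≡ nothing →
              V ⊆ V' → RideLog t0 c g E V' → RideEnd t0 c g h par E V s

  ride-metNew : ∀ t0 e c g h par E V0 V c' → V0 ⊆ V →
    newCarrier G (st (t0 + e) c g h par E V (ride e)) ≡ just c' →
    Eventually (RideEnd t0 c g h par E V0) (st (t0 + e) c g h par E V (ride e))
  ride-metNew t0 e c g h par E V0 V c' V0⊆V eq = later≡ (step-ride-new _ _ _ _ _ _ _ _ _ eq)
    (now (metNew refl (proj₂ found) (proj₁ found) V0⊆V))
    where
      found : pos G c' (t0 + e) ≡ pos G c (t0 + e) × c' ∉ₛ E
      found = newCarrier-just (st (t0 + e) c g h par E V (ride e)) eq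

  rideFor : ∀ r t0 e c g h par E V0 V → e + r ≡ g → V0 ⊆ V → RideLog t0 c e E V →
    Eventually (RideEnd t0 c g h par E V0) (st (t0 + e) c g h par E V (ride e))
  rideFor zero t0 e c g h par E V0 V e+0≡g V0⊆V log
    with newCarrier G (st (t0 + e) c g h par E V (ride e)) in eq
  ... | just c' = ride-metNew t0 e c g h par E V0 V c' V0⊆V eq
  ... | nothing with refl ← trans (sym (+-identityʳ e)) e+0≡g = now (expired refl eq V0⊆V log)
  rideFor (suc r) t0 e c g h par E V0 V e+r≡g V0⊆V log
    with newCarrier G (st (t0 + e) c g h par E V (ride e)) in eq
  ... | just c' = ride-metNew t0 e c g h par E V0 V c' V0⊆V eq
  ... | nothing = later≡ (step-ride-on (t0 + e) c g h par E V e eq (<⇒≢ e<g))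
      (after-move t0 e c g h par E V (ride e) (ride (suc e))
        (rideFor r t0 (suc e) c g h par E V0 (V ∪ ⁅ pos G c (t0 + suc e) ⁆) (trans (sym (+-suc e r)) e+r≡g)
          (λ z∈ → p⊆p∪q _ (V0⊆V z∈))
          (rideLog-extend log (newCarrier-nothing (st (t0 + e) c g h par E V (ride e)) eq))))
    where
      e<g : e < g
      e<g = subst (e <_) e+r≡g (m<m+n e z<s)

  -- The depth-first stack.

  data ParentChain (par : Fin k → Fin k) (h : Fin k) (E : Subset k) : Fin k → List (Fin k) → Set where
    atHome : ParentChain par h E h []
    child  : ∀ {c x stk} → par c ≡ x → c ≢ h → (∃ λ τ → pos G x τ ≡ pos G c τ) → x ∈ₛ E →
             ParentChain par h E x stk → ParentChain par h E c (x ∷ stk)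

  home∈E : ∀ {par h E c stk} → c ∈ₛ E → ParentChain par h E c stk → h ∈ₛ E
  home∈E c∈E atHome                    = c∈E
  home∈E c∈E (child _ _ _ x∈E chain) = home∈E x∈E chain

  chain-mono : ∀ {par par' h E E' c stk} → (∀ d → d ∈ₛ E → par' d ≡ par d) → E ⊆ E' → c ∈ₛ E →
    ParentChain par h E c stk → ParentChain par' h E' c stk
  chain-mono agree E⊆E' c∈E atHome = atHome
  chain-mono agree E⊆E' c∈E (child up c≢h meets x∈E chain) =
    child (trans (agree _ c∈E) up) c≢h meets (E⊆E' x∈E) (chain-mono agree E⊆E' x∈E chain)

  unencountered-decreases : ∀ {E c'} → c' ∉ₛ E → k ∸ ∣ E ∪ ⁅ c' ⁆ ∣ < k ∸ ∣ E ∣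
  unencountered-decreases {E} {c'} c'∉E =
    ∸-monoʳ-< (p⊂q⇒∣p∣<∣q∣ (p⊆p∪q ⁅ c' ⁆ , c' , q⊆p∪q E _ (x∈⁅x⁆ c') , c'∉E)) (∣p∣≤n (E ∪ ⁅ c' ⁆))

  doubling-decreases : ∀ {g} → 1 ≤ g → g < L → L ∸ 2 * g < L ∸ g
  doubling-decreases {g} g≥1 g<L with 2 * g ≤? L
  ... | yes 2g≤L = ∸-monoʳ-< (subst (g <_) (cong (g +_) (sym (+-identityʳ g))) (m<m+n g g≥1)) 2g≤L
  ... | no 2g≰L  = subst (_< L ∸ g) (sym (m≤n⇒m∸n≡0 (<⇒≤ (≰⇒> 2g≰L)))) (m<n⇒0<n∸m g<L)

  module Run (c0 : Fin k) (covered : ∀ z → OnLinkedRoute c0 z) where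

    record Invariant (c : Fin k) (g : ℕ) (h : Fin k) (par : Fin k → Fin k)
                     (E : Subset k) (V : Subset n) (stk : List (Fin k)) : Set where
      field
        current∈E : c ∈ₛ E
        chain     : ParentChain par h E c stk
        guess≥1   : 1 ≤ g
        linked    : Linked c0 c
        finished  : L ≤ g → ∀ d → d ∈ₛ E → d ∉ (c ∷ stk) → Finished E V d
    open Invariant

    invariant-visited : ∀ {c g h par E V V' stk} → V ⊆ V' →
      Invariant c g h par E V stk → Invariant c g h par E V' stk
    invariant-visited V⊆V' inv = record
      { current∈E = current∈E inv ; chain = chain inv ; guess≥1 = guess≥1 inv ; linked = linked inv
      ; finished  = λ long d d∈E d∉ → finished-mono (λ x → x) V⊆V' (finished inv long d d∈E d∉) }

    invariant-fresh : ∀ {c g par V} → 1 ≤ g → Linked c0 c → Invariant c g c par ⁅ c ⁆ V []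
    invariant-fresh {c} g≥1 lc = record
      { current∈E = x∈⁅x⁆ c ; chain = atHome ; guess≥1 = g≥1 ; linked = lc
      ; finished  = λ _ d d∈ d∉ → ⊥-elim (d∉ (here (x∈⁅y⁆⇒x≡y c d∈))) }

    invariant-child : ∀ {t c c' g h par E V V' stk} → Invariant c g h par E V stk →
      c' ∉ₛ E → pos G c' t ≡ pos G c t → V ⊆ V' →
      Invariant c' g h (adopt par c c') (E ∪ ⁅ c' ⁆) V' (c ∷ stk)
    invariant-child {t} {c} {c'} {g} {_} {par} {E} {_} {V'} {stk} inv c'∉E meets V⊆V' = record
      { current∈E = q⊆p∪q E _ (x∈⁅x⁆ c')
      ; chain     = child (cong (λ b → if b then c else par c') (≟-true {c = c'} refl))
                          (λ { refl → c'∉E (home∈E (current∈E inv) (chain inv)) })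
                          (t , sym meets) (p⊆p∪q _ (current∈E inv))
                          (chain-mono agree (p⊆p∪q _) (current∈E inv) (chain inv))
      ; guess≥1   = guess≥1 inv
      ; linked    = meet t (linked inv) (sym meets)
      ; finished  = old-finished }
      where
        agree : ∀ d → d ∈ₛ E → adopt par c c' d ≡ par d
        agree d d∈E = cong (λ b → if b then c else par d) (≟-false (λ { refl → c'∉E d∈E }))
        old-finished : L ≤ g → ∀ d → d ∈ₛ E ∪ ⁅ c' ⁆ → d ∉ (c' ∷ c ∷ stk) → Finished (E ∪ ⁅ c' ⁆) V' d
        old-finished long d d∈ d∉ =
          [ (λ d∈E → finished-mono (p⊆p∪q _) V⊆V' (finished inv long d d∈E (λ d∈s → d∉ (there d∈s))))
          , (λ d∈c' → ⊥-elim (d∉ (here (x∈⁅y⁆⇒x≡y c' d∈c')))) ]′ (x∈p∪q⁻ E _ d∈)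

    finished-after-ride : ∀ {t c g h par E V V' stk} → Invariant c g h par E V stk → V ⊆ V' →
      RideLog t c g E V' → L ≤ g → ∀ d → d ∈ₛ E → d ∉ stk → Finished E V' d
    finished-after-ride {c = c} inv V⊆V' log long d d∈E d∉ with d ≟ c
    ... | yes refl = rideLog-finished log long
    ... | no d≢c   = finished-mono (λ x → x) V⊆V'
                       (finished inv long d d∈E (λ { (here d≡c) → d≢c d≡c ; (there d∈s) → d∉ d∈s }))

    all-finished⇒full : ∀ {c E V} → c ∈ₛ E → Linked c0 c →
      (∀ d → d ∈ₛ E → Finished E V d) → (∣ V ∣ ≡ᵇ n) ≡ true
    all-finished⇒full {c} {E} {V} c∈E lc allFinished = all⇒full V everySite
      where
        everySite : ∀ z → z ∈ₛ V
        everySite z with covered z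
        ... | d , ld , τ , at-z = subst (_∈ₛ V) at-z
              (proj₂ (allFinished d (finished⇒linked∈ allFinished c∈E (linked-trans (linked-sym lc) ld))) τ)

    data Outcome (g : ℕ) (h : Fin k) (E : Subset k) (stk : List (Fin k)) (s : State n k) : Set where
      halts    : mode s ≡ halted → full G s ≡ true → Outcome g h E stk s
      restarts : ∀ {t c par V} → s ≡ st t c (2 * g) c par ⁅ c ⁆ V proc → g < L → Linked c0 c →
                 Outcome g h E stk s
      returns  : ∀ {t x stk' par' E' V'} → stk ≡ x ∷ stk' → s ≡ st t x g h par' E' V' proc → E ⊆ E' →
                 Invariant x g h par' E' V' stk' → Outcome g h E stk s

    outcome-weaken : ∀ {g h E E' stk s} → E ⊆ E' → Outcome g h E' stk s → Outcome g h E stk s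
    outcome-weaken E⊆E' (halts stopped allVisited)    = halts stopped allVisited
    outcome-weaken E⊆E' (restarts eq short lc)        = restarts eq short lc
    outcome-weaken E⊆E' (returns up eq E'⊆E'' inv) = returns up eq (λ z∈ → E'⊆E'' (E⊆E' z∈)) inv

    record Backtrack (c x : Fin k) (g : ℕ) (h : Fin k) (par : Fin k → Fin k)
                     (E : Subset k) (V : Subset n) (stk : List (Fin k)) : Set where
      field
        toParent    : par c ≡ x
        meetsParent : ∃ λ τ → pos G x τ ≡ pos G c τ
        cFinished   : L ≤ g → Finished E V c
        parentInv   : Invariant x g h par E V stk
    open Backtrack

    backtrack-start : ∀ {t c x g h par E V V' stk} → Invariant c g h par E V (x ∷ stk) → V ⊆ V' →
      RideLog t c g E V' → Backtrack c x g h par E V' stk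
    backtrack-start inv V⊆V' log with chain inv
    ... | child toX _ (τ , meets) x∈E chain' = record
      { toParent    = toX
      ; meetsParent = τ , meets
      ; cFinished   = rideLog-finished log
      ; parentInv   = record
        { current∈E = x∈E ; chain = chain' ; guess≥1 = guess≥1 inv
        ; linked    = meet τ (linked inv) (sym meets)
        ; finished  = λ long d d∈E d∉ → finished-after-ride inv V⊆V' log long d d∈E d∉ } }

    backtracker-linked : ∀ {c x g h par E V stk} → Backtrack c x g h par E V stk → Linked c0 c
    backtracker-linked b = meet (proj₁ (meetsParent b)) (linked (parentInv b)) (proj₂ (meetsParent b))

    -- Meeting an unencountered carrier while backtracking restarts; this only
    -- happens for g < L, since otherwise c is finished.
    back-metNew : ∀ t c x g h par E V0 V stk e c' → Backtrack c x g h par E V0 stk →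
      newCarrier G (st t c g h par E V (back e)) ≡ just c' →
      Eventually (Outcome g h E (x ∷ stk)) (st t c g h par E V (back e))
    back-metNew t c x g h par E V0 V stk e c' b eq =
      later≡ (step-back-new t c g h par E V e c' eq) (now (restarts refl short (backtracker-linked b)))
      where
        found : pos G c' t ≡ pos G c t × c' ∉ₛ E
        found = newCarrier-just (st t c g h par E V (back e)) eq
        short : g < L
        short = ≰⇒> λ long → proj₂ found (proj₁ (cFinished b long) c' t (sym (proj₁ found)))

    back-atParent : ∀ t c x g h par E V0 V stk e → Backtrack c x g h par E V0 stk → V0 ⊆ V →
      newCarrier G (st t c g h par E V (back e)) ≡ nothing → pos G (par c) t ≡ pos G c t →
      Eventually (Outcome g h E (x ∷ stk)) (st t c g h par E V (back e))
    back-atParent t c x g h par E V0 V stk e b V0⊆V eq meets =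
      later≡ (step-back-parent t c g h par E V e eq meets)
        (now (returns refl (cong (λ y → st t y g h par E V proc) (toParent b)) (λ z → z)
                      (invariant-visited V0⊆V (parentInv b))))

    -- A backtrack started at t1 with r time units left ends within r + 1
    -- steps; it can only fail to reach the parent when g < L, because any
    -- L consecutive times include one at which c meets its parent.
    backtrackFor : ∀ r t1 e c x g h par E V0 V stk → e + r ≡ g → V0 ⊆ V →
      (∀ j → j < e → pos G x (t1 + j) ≢ pos G c (t1 + j)) → Backtrack c x g h par E V0 stk →
      Eventually (Outcome g h E (x ∷ stk)) (st (t1 + e) c g h par E V (back e))
    backtrackFor zero t1 e c x g h par E V0 V stk e+0≡g V0⊆V notYet b
      with newCarrier G (st (t1 + e) c g h par E V (back e)) in eq
    ... | just c' = back-metNew (t1 + e) c x g h par E V0 V stk e c' b eq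
    ... | nothing with pos G (par c) (t1 + e) ≟ pos G c (t1 + e)
    ...   | yes meets = back-atParent (t1 + e) c x g h par E V0 V stk e b V0⊆V eq meets
    ...   | no apart with refl ← trans (sym (+-identityʳ e)) e+0≡g =
      later≡ (step-back-restart (t1 + e) c g h par E V eq apart) (now (restarts refl short (backtracker-linked b)))
      where
        short : e < L
        short = ≰⇒> λ long → let (τ , meets) = meetsParent b ; (j , j<L , same) = window t1 τ in
          notYet j (<-≤-trans j<L long) (trans (same x) (trans meets (sym (same c))))
    backtrackFor (suc r) t1 e c x g h par E V0 V stk e+r≡g V0⊆V notYet b
      with newCarrier G (st (t1 + e) c g h par E V (back e)) in eq
    ... | just c' = back-metNew (t1 + e) c x g h par E V0 V stk e c' b eq
    ... | nothing with pos G (par c) (t1 + e) ≟ pos G c (t1 + e)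
    ...   | yes meets = back-atParent (t1 + e) c x g h par E V0 V stk e b V0⊆V eq meets
    ...   | no apart = later≡ (step-back-on (t1 + e) c g h par E V e eq apart (<⇒≢ e<g))
      (after-move t1 e c g h par E V (back e) (back (suc e))
        (backtrackFor r t1 (suc e) c x g h par E V0 (V ∪ ⁅ pos G c (t1 + suc e) ⁆) stk
          (trans (sym (+-suc e r)) e+r≡g) (λ z∈ → p⊆p∪q _ (V0⊆V z∈)) notYet' b))
      where
        e<g : e < g
        e<g = subst (e <_) e+r≡g (m<m+n e z<s)
        notYet' : ∀ j → j < suc e → pos G x (t1 + j) ≢ pos G c (t1 + j)
        notYet' j j≤e = [ notYet j , (λ { refl → subst (λ y → pos G y (t1 + e) ≢ _) (toParent b) apart }) ]′
                          (m≤n⇒m<n∨m≡n (≤-pred j≤e))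

    -- Exploring.

    -- The ride with c has expired: at the Home the agent halts if all sites
    -- are visited and restarts otherwise (which needs g < L, since with g ≥ L
    -- everything encountered is finished); elsewhere it backtracks.
    rideExpired : ∀ t c g h par E V V1 stk → Invariant c g h par E V stk → V ⊆ V1 →
      newCarrier G (st (t + g) c g h par E V1 (ride g)) ≡ nothing → RideLog t c g E V1 →
      Eventually (Outcome g h E stk) (st (t + g) c g h par E V1 (ride g))
    rideExpired t c g h par E V V1 stk inv V⊆V1 nq log with chain inv
    ... | atHome with full G (st (t + g) c g c par E V1 (ride g)) in fq
    ...   | true  = later≡ (step-ride-halt (t + g) c g par E V1 nq fq) (now (halts refl fq))
    ...   | false = later≡ (step-ride-restart (t + g) c g par E V1 nq fq) (now (restarts refl short (linked inv)))
      where
        short : g < L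
        short = ≰⇒> λ long → true≢false (trans (sym (all-finished⇒full (current∈E inv) (linked inv)
                  (λ d d∈E → finished-after-ride inv V⊆V1 log long d d∈E (λ ())))) fq)
    rideExpired t c g h par E V V1 (x ∷ stk) inv V⊆V1 nq log | child _ c≢h _ _ _ =
      later≡ (step-ride-backtrack (t + g) c g h par E V1 nq c≢h)
        (subst (λ T → Eventually (Outcome g h E (x ∷ stk)) (st T c g h par E V1 (back 0))) (+-identityʳ (t + g))
          (backtrackFor g (t + g) 0 c x g h par E V1 V1 stk refl (λ z → z) (λ _ ())
            (backtrack-start inv V⊆V1 log)))

    explore : ∀ f t c g h par E V stk → k ∸ ∣ E ∣ ≤ f → Invariant c g h par E V stk →
      Eventually (Outcome g h E stk) (st t c g h par E V proc)

    descend : ∀ f t c c' g h par E V stk → c' ∉ₛ E → k ∸ ∣ E ∣ ≤ f →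
      Invariant c' g h (adopt par c c') (E ∪ ⁅ c' ⁆) V (c ∷ stk) →
      Eventually (Outcome g h E stk) (st t c' g h (adopt par c c') (E ∪ ⁅ c' ⁆) V proc)

    explore f t c g h par E V stk bound inv with full G (st t c g h par E V proc) in fq
    ... | true  = later≡ (step-proc-full t c g h par E V fq) (now (halts refl fq))
    ... | false = later≡ (step-proc-ride t c g h par E V fq)
      (subst (λ T → Eventually (RideEnd t c g h par E V) (st T c g h par E V (ride 0))) (+-identityʳ t)
        (rideFor g t 0 c g h par E V V refl (λ z → z) rideLog-empty) then rideEnded)
      where
        rideEnded : ∀ s → RideEnd t c g h par E V s → Eventually (Outcome g h E stk) s
        rideEnded s (expired refl nq V⊆V1 log) = rideExpired t c g h par E V _ stk inv V⊆V1 nq log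
        rideEnded s (metNew refl c'∉E meets V⊆V1) =
          descend f _ c _ g h par E _ stk c'∉E bound (invariant-child inv c'∉E meets V⊆V1)

    descend zero t c c' g h par E V stk c'∉E bound inv' =
      ⊥-elim (<⇒≱ (<-≤-trans (unencountered-decreases c'∉E) bound) z≤n)
    descend (suc f) t c c' g h par E V stk c'∉E bound inv' =
      explore f t c' g h (adopt par c c') (E ∪ ⁅ c' ⁆) V (c ∷ stk) bound' inv' then backAtC
      where
        bound' : k ∸ ∣ E ∪ ⁅ c' ⁆ ∣ ≤ f
        bound' = ≤-pred (≤-trans (unencountered-decreases c'∉E) bound)
        backAtC : ∀ s → Outcome g h (E ∪ ⁅ c' ⁆) (c ∷ stk) s → Eventually (Outcome g h E stk) s
        backAtC s (halts stopped allVisited) = now (halts stopped allVisited)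
        backAtC s (restarts refl short lc)   = now (restarts refl short lc)
        backAtC s (returns refl refl E'⊆E2 inv2) =
          explore f _ c g h _ _ _ stk (≤-trans (∸-monoʳ-≤ k (p⊆q⇒∣p∣≤∣q∣ E'⊆E2)) bound') inv2
          then λ s' out → now (outcome-weaken (λ z∈ → E'⊆E2 (p⊆p∪q _ z∈)) out)

    Done : State n k → Set
    Done s = mode s ≡ halted × full G s ≡ true

    phase : ∀ f t c g par E V → L ∸ g ≤ f → Invariant c g c par E V [] →
      Eventually Done (st t c g c par E V proc)
    phase f t c g par E V bound inv = explore k t c g c par E V [] (m∸n≤m k ∣ E ∣) inv then next f bound
      where
        next : ∀ f → L ∸ g ≤ f → ∀ s → Outcome g c E [] s → Eventually Done s
        next _ _ s (halts stopped allVisited) = now (stopped , allVisited)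
        next zero    bound s (restarts refl g<L lc) = ⊥-elim (<⇒≱ (m<n⇒0<n∸m g<L) bound)
        next (suc f) bound s (restarts refl g<L lc) =
          phase f _ _ (2 * g) _ _ _ (≤-pred (≤-trans (doubling-decreases (guess≥1 inv) g<L) bound))
                (invariant-fresh (≤-trans (guess≥1 inv) (m≤m+n g _)) lc)

  visited-step : ∀ s → visited (step G s) ≡ visited s ⊎ visited (step G s) ≡ visited s ∪ ⁅ site G (step G s) ⁆
  visited-step (st t c g h par E V halted) = inj₁ refl
  visited-step (st t c g h par E V proc) with full G (st t c g h par E V proc)
  ... | true  = inj₁ refl
  ... | false = inj₁ refl
  visited-step (st t c g h par E V (ride e)) with newCarrier G (st t c g h par E V (ride e))
  ... | just c' = inj₁ refl
  ... | nothing with e ≡ᵇ g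
  ...   | false = inj₂ refl
  ...   | true with ⌊ c ≟ h ⌋
  ...     | false = inj₁ refl
  ...     | true with full G (st t c g h par E V (ride e))
  ...       | true  = inj₁ refl
  ...       | false = inj₁ refl
  visited-step (st t c g h par E V (back e)) with newCarrier G (st t c g h par E V (back e))
  ... | just c' = inj₁ refl
  ... | nothing with ⌊ pos G (par c) t ≟ pos G c t ⌋
  ...   | true  = inj₁ refl
  ...   | false with e ≡ᵇ g
  ...     | true  = inj₁ refl
  ...     | false = inj₂ refl

  run-suc : ∀ s i → run G s (suc i) ≡ step G (run G s i)
  run-suc s zero    = refl
  run-suc s (suc i) = run-suc (step G s) i

  visited-grows : ∀ s {z} → z ∈ₛ visited (step G s) → z ∈ₛ visited s ⊎ site G (step G s) ≡ z
  visited-grows s z∈ with visited-step s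
  ... | inj₁ same  = inj₁ (subst (_ ∈ₛ_) same z∈)
  ... | inj₂ added = [ inj₁ , (λ new → inj₂ (sym (x∈⁅y⁆⇒x≡y _ new))) ]′ (x∈p∪q⁻ _ _ (subst (_ ∈ₛ_) added z∈))

  visited⇒seen : ∀ s → (∀ {z} → z ∈ₛ visited s → site G s ≡ z) →
    ∀ i z → z ∈ₛ visited (run G s i) → ∃ λ j → j ≤ i × site G (run G s j) ≡ z
  visited⇒seen s initially zero    z z∈ = 0 , z≤n , initially z∈
  visited⇒seen s initially (suc i) z z∈ =
    [ (λ old → let (j , j≤i , seen) = visited⇒seen s initially i z old in j , m≤n⇒m≤1+n j≤i , seen)
    , (λ new → suc i , ≤-refl , trans (cong (site G) (run-suc s i)) new) ]′
    (visited-grows (run G s i) (subst (λ s' → z ∈ₛ visited s') (run-suc s i) z∈))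

theorem12 : ∀ {n k} (G : PV n k) → Feasible G →
    (g0 : ℕ) → 1 ≤ g0 → (c0 : Fin k) →
    ∃ λ (N : ℕ) → isHalted G (run G (initial G g0 c0) N) ×
    ((z : Fin n) → ∃ λ (i : ℕ) → i ≤ N × site G (run G (initial G g0 c0) i) ≡ z)
theorem12 G feasible g0 g0≥1 c0 =
  N , proj₁ done , λ z → visited⇒seen s0 initially N z (full⇒all _ (proj₂ done) z)
  where
    open Correctness G
    open Run c0 (feasible⇒covered feasible c0)
    s0 : State _ _
    s0 = initial G g0 c0
    run-done : Eventually Done s0
    run-done = phase L 0 c0 g0 (λ c → c) ⁅ c0 ⁆ ⁅ pos G c0 0 ⁆ (m∸n≤m L g0) (invariant-fresh g0≥1 start)
    N : ℕ
    N = Eventually.steps run-done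
    done : Done (run G s0 N)
    done = Eventually.holds run-done
    initially : ∀ {z} → z ∈ₛ visited s0 → site G s0 ≡ z
    initially z∈ = sym (x∈⁅y⁆⇒x≡y _ z∈)
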